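{- Let $\lambda$ be a nonzero real number and let $n\ge 0$ be an integer. Then, as functions of $x$, \[ \frac{1}{e^{x}}\,(XD)_{n,\lambda}\,e^{x}=\phi_{n,\lambda}(x), \] where $X$ is the operator of multiplication by $x$, $D=\frac{d}{dx}$, and $(XD)_{n,\lambda}$ is the operator $(XD)(XD-\lambda)(XD-2\lambda)\cdots(XD-(n-1)\lambda)$ (the identity operator when $n=0$).
   Context: For nonzero real $\lambda$, the degenerate falling factorial is $(x)_{0,\lambda}=1$, $(x)_{n,\lambda}=x(x-\lambda)(x-2\lambda)\cdots(x-(n-1)\lambda)$ for $n\ge1$. For an operator $T$, $(T)_{n,\lambda}$ denotes $T(T-\lambda)\cdots(T-(n-1)\lambda)$ (identity if $n=0$). The degenerate exponentials are the formal power series $e_\lambda^{x}(t)=\sum_{n\ge0}(x)_{n,\lambda}\frac{t^n}{n!}$ and $e_\lambda(t)=e_\lambda^{1}(t)$. The degenerate Bell polynomials $\phi_{n,\lambda}(x)$ are defined by $e^{x(e_\lambda(t)-1)}=\sum_{n\ge0}\phi_{n,\lambda}(x)\frac{t^n}{n!}$; equivalently $\phi_{n,\lambda}(x)=\sum_{k=0}^n {n\brace k}_\lambda x^k$, where the degenerate Stirling numbers of the second kind ${n\brace k}_\lambda$ are defined by $(x)_{n,\lambda}=\sum_{k=0}^n {n\brace k}_\lambda (x)_k$ with $(x)_k=x(x-1)\cdots(x-k+1)$, $(x)_0=1$. -}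

module Defs where

open import Level using (Level)
open import Data.Nat as ℕ using (ℕ; zero; suc)
open import Data.Nat.Combinatorics using (_C_)
open import Data.Nat using (_!)
open import Algebra.Bundles using (CommutativeRing)
open import Data.Bool using (true; false)

-- Formal power series in x over a commutative ring R, represented by their
-- "exponential" coefficients: a series f : Series stands for
--     Σ_{k ≥ 0} f k · x^k / k! .
-- This representation needs no division, and makes e^x the constant
-- sequence 1.
module Ops {c ℓ : Level} (R : CommutativeRing c ℓ) where
  open CommutativeRing R

  Series : Set c
  Series = ℕ → Carrier

  fromℕ : ℕ → Carrier
  fromℕ zero    = 0#
  fromℕ (suc n) = 1# + fromℕ n

  sumTo : ℕ → (ℕ → Carrier) → Carrier
  sumTo zero    f = f 0
  sumTo (suc n) f = sumTo n f + f (suc n)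

  _⊕_ : Series → Series → Series
  (f ⊕ g) k = f k + g k

  _⊖_ : Series → Series → Series
  (f ⊖ g) k = f k - g k

  _·_ : Carrier → Series → Series
  (a · f) k = a * f k

  -- Cauchy product of series (in exponential coefficients: binomial convolution)
  _⋆_ : Series → Series → Series
  (f ⋆ g) n = sumTo n (λ k → fromℕ (n C k) * (f k * g (n ℕ.∸ k)))

  -- D = d/dx :  D (Σ f k x^k/k!) = Σ f (k+1) x^k/k!
  D : Series → Series
  D f k = f (suc k)

  -- X = multiplication by x :  x · x^k/k! = (k+1) · x^(k+1)/(k+1)!
  X : Series → Series
  X f zero    = 0#
  X f (suc k) = fromℕ (suc k) * f k

  XD : Series → Series
  XD f = X (D f)

  fallingXD : Carrier → ℕ → Series → Series
  fallingXD lam zero    f = f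
  fallingXD lam (suc n) f = fallingXD lam n (XD f ⊖ ((fromℕ n * lam) · f))

  expS : Series
  expS k = 1#

  expNegS : Series
  expNegS zero    = 1#
  expNegS (suc k) = - expNegS k

  stirling2 : Carrier → ℕ → ℕ → Carrier
  stirling2 lam zero    zero    = 1#
  stirling2 lam zero    (suc k) = 0#
  stirling2 lam (suc n) zero    = 0#
  stirling2 lam (suc n) (suc k) =
    stirling2 lam n k + (fromℕ (suc k) - fromℕ n * lam) * stirling2 lam n (suc k)

  -- a polynomial Σ_{k=0}^{m} a k x^k (a given by its ordinary coefficients,
  -- truncated at degree m), viewed as a series: exponential coefficient k!·a k
  polyS : ℕ → (ℕ → Carrier) → Series
  polyS m a k with k ℕ.≤ᵇ m
  ... | true  = fromℕ (k !) * a k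
  ... | false = 0#

  bellφ : Carrier → ℕ → Series
  bellφ lam n = polyS n (stirling2 lam n)

{-# OPTIONS --safe #-}
-- On exponential coefficients XD multiplies the k-th coefficient by k, so (XD)_{n,λ} acts
-- diagonally by (k)_{n,λ} and (XD)_{n+1,λ} = (XD - nλ) ∘ (XD)_{n,λ}.  Since XD is a derivation
-- and XD e^{-x} = -x e^{-x}, conjugation gives e^{-x} ∘ (XD - a) ∘ e^{x} = XD + X - a.  Hence
-- ψ_n = e^{-x} (XD)_{n,λ} e^{x} satisfies ψ_{n+1} = (XD + X - nλ) ψ_n, which on coefficients is
-- the recurrence {n+1, k}_λ = {n, k-1}_λ + (k - nλ) {n, k}_λ obeyed by φ_{n,λ}.  For n = 0 both
-- sides are 1, since alternating binomial sums vanish.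
module Submission where

open import Defs
open import Level using (Level)
open import Data.Nat using (ℕ)
open import Algebra.Bundles using (CommutativeRing)
open import Relation.Nullary using (¬_)

open import Data.Nat as ℕ using (zero; suc; _!; s≤s)
import Data.Nat.Properties as ℕ
open import Data.Nat.Combinatorics using (_C_; nCk+nC[k+1]≡[n+1]C[k+1]; k>n⇒nCk≡0; nC1≡n)
open import Data.Integer as ℤ using (ℤ; +_; -[1+_]; _◃_; sign; ∣_∣)
import Data.Integer.Properties as ℤ
open import Data.Sign as Sign using (Sign)
open import Data.Maybe using (Maybe; just; nothing)
open import Data.Bool using (true; false; T)
open import Relation.Nullary using (yes; no)
open import Relation.Binary.PropositionalEquality as ≡ using (_≡_)
open import Algebra.Solver.Ring.AlmostCommutativeRing
  using (fromCommutativeRing; _-Raw-AlmostCommutative⟶_)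
import Algebra.Solver.Ring as RingSolver
import Algebra.Properties.Ring as RingProperties
import Algebra.Properties.Semiring.Mult as SemiringMultiplication
import Algebra.Properties.CommutativeSemigroup as CommSemigroupProperties

[k+1]*[n+1]C[k+1]≡[n+1]*nCk : ∀ n k → suc k ℕ.* (suc n C suc k) ≡ suc n ℕ.* (n C k)
[k+1]*[n+1]C[k+1]≡[n+1]*nCk zero    zero    = ≡.refl
[k+1]*[n+1]C[k+1]≡[n+1]*nCk zero    (suc k) = ℕ.*-zeroʳ (suc (suc k))
[k+1]*[n+1]C[k+1]≡[n+1]*nCk (suc n) zero    =
  ≡.trans (ℕ.*-identityˡ _) (≡.trans (nC1≡n (suc (suc n))) (≡.sym (ℕ.*-identityʳ _)))
[k+1]*[n+1]C[k+1]≡[n+1]*nCk (suc n) (suc k) = begin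
  suc (suc k) ℕ.* (suc (suc n) C suc (suc k))
    ≡⟨ ≡.cong (suc (suc k) ℕ.*_) (nCk+nC[k+1]≡[n+1]C[k+1] (suc n) (suc k)) ⟨
  suc (suc k) ℕ.* (a ℕ.+ b)                  ≡⟨ ℕ.*-distribˡ-+ (suc (suc k)) a b ⟩
  (a ℕ.+ suc k ℕ.* a) ℕ.+ suc (suc k) ℕ.* b  ≡⟨ ℕ.+-assoc a _ _ ⟩
  a ℕ.+ (suc k ℕ.* a ℕ.+ suc (suc k) ℕ.* b)
    ≡⟨ ≡.cong₂ (λ u v → a ℕ.+ (u ℕ.+ v)) ([k+1]*[n+1]C[k+1]≡[n+1]*nCk n k)
                                          ([k+1]*[n+1]C[k+1]≡[n+1]*nCk n (suc k)) ⟩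
  a ℕ.+ (suc n ℕ.* x ℕ.+ suc n ℕ.* y)        ≡⟨ ≡.cong (a ℕ.+_) (ℕ.*-distribˡ-+ (suc n) x y) ⟨
  a ℕ.+ suc n ℕ.* (x ℕ.+ y)
    ≡⟨ ≡.cong (λ u → a ℕ.+ suc n ℕ.* u) (nCk+nC[k+1]≡[n+1]C[k+1] n k) ⟩
  a ℕ.+ suc n ℕ.* a                          ∎
  where
  open ≡.≡-Reasoning
  a = suc n C suc k
  b = suc n C suc (suc k)
  x = n C k
  y = n C suc k

-- Algebra.Solver.Ring needs a coefficient ring mapping into R; ℤ maps into every commutative ring.
module IntegerCoefficients {c ℓ : Level} (R : CommutativeRing c ℓ) where
  open CommutativeRing R
  open Ops R using (fromℕ)
  open RingProperties ring using (-0#≈0#; -‿+-comm; -‿involutive; -1*x≈-x)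
  open SemiringMultiplication semiring using (_×_; ×-homo-+; ×1-homo-*)
  open CommSemigroupProperties +-commutativeSemigroup
    using () renaming (interchange to +-interchange)
  open CommSemigroupProperties *-commutativeSemigroup
    using () renaming (interchange to *-interchange)
  open import Relation.Binary.Reasoning.Setoid setoid

  fromℕ≡×1# : ∀ n → fromℕ n ≡ n × 1#
  fromℕ≡×1# zero    = ≡.refl
  fromℕ≡×1# (suc n) = ≡.cong (λ x → 1# + x) (fromℕ≡×1# n)

  fromℕ-homo-+ : ∀ m n → fromℕ (m ℕ.+ n) ≈ fromℕ m + fromℕ n
  fromℕ-homo-+ m n rewrite fromℕ≡×1# (m ℕ.+ n) | fromℕ≡×1# m | fromℕ≡×1# n =
    ×-homo-+ 1# m n

  fromℕ-homo-* : ∀ m n → fromℕ (m ℕ.* n) ≈ fromℕ m * fromℕ n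
  fromℕ-homo-* m n rewrite fromℕ≡×1# (m ℕ.* n) | fromℕ≡×1# m | fromℕ≡×1# n =
    ×1-homo-* m n

  fromℤ : ℤ → Carrier
  fromℤ (+ n)    = fromℕ n
  fromℤ -[1+ n ] = - fromℕ (suc n)

  fromℤ-⊖ : ∀ m n → fromℤ (m ℤ.⊖ n) ≈ fromℕ m - fromℕ n
  fromℤ-⊖ zero    zero    = sym (-‿inverseʳ 0#)
  fromℤ-⊖ zero    (suc n) = sym (+-identityˡ _)
  fromℤ-⊖ (suc m) zero    = sym (trans (+-congˡ -0#≈0#) (+-identityʳ _))
  fromℤ-⊖ (suc m) (suc n) rewrite ℤ.[1+m]⊖[1+n]≡m⊖n m n = begin
    fromℤ (m ℤ.⊖ n)                    ≈⟨ fromℤ-⊖ m n ⟩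
    fromℕ m - fromℕ n                  ≈⟨ +-identityˡ _ ⟨
    0# + (fromℕ m - fromℕ n)           ≈⟨ +-congʳ (-‿inverseʳ 1#) ⟨
    (1# - 1#) + (fromℕ m - fromℕ n)    ≈⟨ +-interchange 1# (- 1#) (fromℕ m) (- fromℕ n) ⟩
    (1# + fromℕ m) + (- 1# - fromℕ n)  ≈⟨ +-congˡ (-‿+-comm 1# (fromℕ n)) ⟩
    fromℕ (suc m) - fromℕ (suc n)      ∎

  fromℤ-homo-+ : ∀ i j → fromℤ (i ℤ.+ j) ≈ fromℤ i + fromℤ j
  fromℤ-homo-+ (+ m)    (+ n)    = fromℕ-homo-+ m n
  fromℤ-homo-+ (+ m)    -[1+ n ] = fromℤ-⊖ m (suc n)
  fromℤ-homo-+ -[1+ m ] (+ n)    = trans (fromℤ-⊖ n (suc m)) (+-comm _ _)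
  fromℤ-homo-+ -[1+ m ] -[1+ n ] = begin
    - fromℕ (suc (suc (m ℕ.+ n)))        ≡⟨ ≡.cong (λ k → - fromℕ (suc k)) (ℕ.+-suc m n) ⟨
    - fromℕ (suc m ℕ.+ suc n)            ≈⟨ -‿cong (fromℕ-homo-+ (suc m) (suc n)) ⟩
    - (fromℕ (suc m) + fromℕ (suc n))    ≈⟨ -‿+-comm _ _ ⟨
    - fromℕ (suc m) + - fromℕ (suc n)    ∎

  fromSign : Sign → Carrier
  fromSign Sign.+ = 1#
  fromSign Sign.- = - 1#

  fromSign-homo-* : ∀ s t → fromSign (s Sign.* t) ≈ fromSign s * fromSign t
  fromSign-homo-* Sign.+ t      = sym (*-identityˡ _)
  fromSign-homo-* Sign.- Sign.+ = sym (*-identityʳ _)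
  fromSign-homo-* Sign.- Sign.- = sym (trans (-1*x≈-x (- 1#)) (-‿involutive 1#))

  fromℤ-◃ : ∀ s n → fromℤ (s ◃ n) ≈ fromSign s * fromℕ n
  fromℤ-◃ s      zero    = sym (zeroʳ _)
  fromℤ-◃ Sign.+ (suc n) = sym (*-identityˡ _)
  fromℤ-◃ Sign.- (suc n) = sym (-1*x≈-x _)

  fromℤ≈sign*abs : ∀ i → fromℤ i ≈ fromSign (sign i) * fromℕ ∣ i ∣
  fromℤ≈sign*abs i =
    trans (reflexive (≡.cong fromℤ (≡.sym (ℤ.◃-inverse i)))) (fromℤ-◃ (sign i) ∣ i ∣)

  fromℤ-homo-* : ∀ i j → fromℤ (i ℤ.* j) ≈ fromℤ i * fromℤ j
  fromℤ-homo-* i j = begin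
    fromℤ (sign i Sign.* sign j ◃ ∣ i ∣ ℕ.* ∣ j ∣)
      ≈⟨ fromℤ-◃ (sign i Sign.* sign j) (∣ i ∣ ℕ.* ∣ j ∣) ⟩
    fromSign (sign i Sign.* sign j) * fromℕ (∣ i ∣ ℕ.* ∣ j ∣)
      ≈⟨ *-cong (fromSign-homo-* (sign i) (sign j)) (fromℕ-homo-* ∣ i ∣ ∣ j ∣) ⟩
    (fromSign (sign i) * fromSign (sign j)) * (fromℕ ∣ i ∣ * fromℕ ∣ j ∣)
      ≈⟨ *-interchange _ _ _ _ ⟩
    (fromSign (sign i) * fromℕ ∣ i ∣) * (fromSign (sign j) * fromℕ ∣ j ∣)
      ≈⟨ *-cong (fromℤ≈sign*abs i) (fromℤ≈sign*abs j) ⟨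
    fromℤ i * fromℤ j ∎

  fromℤ-homo-neg : ∀ i → fromℤ (ℤ.- i) ≈ - fromℤ i
  fromℤ-homo-neg (+ zero)  = sym -0#≈0#
  fromℤ-homo-neg (+ suc n) = refl
  fromℤ-homo-neg -[1+ n ]  = sym (-‿involutive _)

  fromℤ-morphism : ℤ.+-*-rawRing -Raw-AlmostCommutative⟶ fromCommutativeRing R
  fromℤ-morphism = record
    { ⟦_⟧    = fromℤ
    ; +-homo = fromℤ-homo-+
    ; *-homo = fromℤ-homo-*
    ; -‿homo = fromℤ-homo-neg
    ; 0-homo = refl
    ; 1-homo = +-identityʳ 1#
    }

  fromℤ-≟ : ∀ i j → Maybe (fromℤ i ≈ fromℤ j)
  fromℤ-≟ i j with i ℤ.≟ j
  ... | yes ≡.refl = just refl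
  ... | no _       = nothing

  open RingSolver ℤ.+-*-rawRing (fromCommutativeRing R) fromℤ-morphism fromℤ-≟ public
    using (solve; _:=_; _:+_; _:*_; _:-_; :-_)

module ExponentialSeries {c ℓ : Level} (R : CommutativeRing c ℓ) where
  open CommutativeRing R
  open Ops R
  open IntegerCoefficients R
  open RingProperties ring using (-0#≈0#; -‿+-comm; -‿distribˡ-*; -‿distribʳ-*)
  open CommSemigroupProperties +-commutativeSemigroup
    using (x∙yz≈y∙xz) renaming (interchange to +-interchange)
  open import Relation.Binary.Reasoning.Setoid setoid

  sumTo-cong≤ : ∀ m {f g : ℕ → Carrier} → (∀ k → k ℕ.≤ m → f k ≈ g k) → sumTo m f ≈ sumTo m g
  sumTo-cong≤ zero    f≈g = f≈g 0 ℕ.z≤n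
  sumTo-cong≤ (suc m) f≈g =
    +-cong (sumTo-cong≤ m (λ k k≤m → f≈g k (ℕ.m≤n⇒m≤1+n k≤m))) (f≈g (suc m) ℕ.≤-refl)

  sumTo-cong : ∀ m {f g : ℕ → Carrier} → (∀ k → f k ≈ g k) → sumTo m f ≈ sumTo m g
  sumTo-cong m f≈g = sumTo-cong≤ m (λ k _ → f≈g k)

  sumTo-zero : ∀ m {f : ℕ → Carrier} → (∀ k → f k ≈ 0#) → sumTo m f ≈ 0#
  sumTo-zero zero    f≈0 = f≈0 0
  sumTo-zero (suc m) f≈0 = trans (+-cong (sumTo-zero m f≈0) (f≈0 (suc m))) (+-identityʳ 0#)

  sumTo-suc : ∀ m (f : ℕ → Carrier) → sumTo (suc m) f ≈ f 0 + sumTo m (λ k → f (suc k))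
  sumTo-suc zero    f = refl
  sumTo-suc (suc m) f = trans (+-congʳ (sumTo-suc m f)) (+-assoc _ _ _)

  sumTo-+ : ∀ m (f g : ℕ → Carrier) → sumTo m (λ k → f k + g k) ≈ sumTo m f + sumTo m g
  sumTo-+ zero    f g = refl
  sumTo-+ (suc m) f g = trans (+-congʳ (sumTo-+ m f g)) (+-interchange _ _ _ _)

  sumTo-neg : ∀ m (f : ℕ → Carrier) → sumTo m (λ k → - f k) ≈ - sumTo m f
  sumTo-neg zero    f = refl
  sumTo-neg (suc m) f = trans (+-congʳ (sumTo-neg m f)) (-‿+-comm _ _)

  sumTo-*ˡ : ∀ m a (f : ℕ → Carrier) → sumTo m (λ k → a * f k) ≈ a * sumTo m f
  sumTo-*ˡ zero    a f = refl
  sumTo-*ˡ (suc m) a f = trans (+-congʳ (sumTo-*ˡ m a f)) (sym (distribˡ _ _ _))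

  binom : ℕ → ℕ → Carrier
  binom m k = fromℕ (m C k)

  binom-pascal : ∀ m k → binom (suc m) (suc k) ≈ binom m k + binom m (suc k)
  binom-pascal m k = trans (reflexive (≡.cong fromℕ (≡.sym (nCk+nC[k+1]≡[n+1]C[k+1] m k))))
                           (fromℕ-homo-+ (m C k) (m C suc k))

  binom-absorb : ∀ m k → fromℕ (suc k) * binom (suc m) (suc k) ≈ fromℕ (suc m) * binom m k
  binom-absorb m k = begin
    fromℕ (suc k) * binom (suc m) (suc k)  ≈⟨ fromℕ-homo-* (suc k) (suc m C suc k) ⟨
    fromℕ (suc k ℕ.* (suc m C suc k))
      ≡⟨ ≡.cong fromℕ ([k+1]*[n+1]C[k+1]≡[n+1]*nCk m k) ⟩
    fromℕ (suc m ℕ.* (m C k))              ≈⟨ fromℕ-homo-* (suc m) (m C k) ⟩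
    fromℕ (suc m) * binom m k              ∎

  binom[n,1+n]≈0 : ∀ m → binom m (suc m) ≈ 0#
  binom[n,1+n]≈0 m = reflexive (≡.cong fromℕ (k>n⇒nCk≡0 (ℕ.n<1+n m)))

  binomialSum-suc : ∀ m (f : ℕ → Carrier) →
    sumTo (suc m) (λ k → binom (suc m) k * f k) ≈ sumTo m (λ k → binom m k * (f k + f (suc k)))
  binomialSum-suc m f = begin
    sumTo (suc m) (λ k → binom (suc m) k * f k)
      ≈⟨ sumTo-suc m _ ⟩
    binom m 0 * f 0 + sumTo m (λ k → binom (suc m) (suc k) * f (suc k))
      ≈⟨ +-congˡ (sumTo-cong m (λ k → trans (*-congʳ (binom-pascal m k)) (distribʳ _ _ _))) ⟩
    binom m 0 * f 0 + sumTo m (λ k → binom m k * f (suc k) + binom m (suc k) * f (suc k))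
      ≈⟨ +-congˡ (sumTo-+ m _ _) ⟩
    binom m 0 * f 0 + (S₁ + sumTo m (λ k → binom m (suc k) * f (suc k)))
      ≈⟨ x∙yz≈y∙xz _ _ _ ⟩
    S₁ + (binom m 0 * f 0 + sumTo m (λ k → binom m (suc k) * f (suc k)))
      ≈⟨ +-congˡ (sumTo-suc m _) ⟨
    S₁ + (S₀ + binom m (suc m) * f (suc m))
      ≈⟨ +-congˡ (+-congˡ (trans (*-congʳ (binom[n,1+n]≈0 m)) (zeroˡ _))) ⟩
    S₁ + (S₀ + 0#)
      ≈⟨ trans (+-congˡ (+-identityʳ S₀)) (+-comm S₁ S₀) ⟩
    S₀ + S₁
      ≈⟨ trans (sumTo-cong m (λ k → distribˡ _ _ _)) (sumTo-+ m _ _) ⟨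
    sumTo m (λ k → binom m k * (f k + f (suc k))) ∎
    where
    S₀ = sumTo m (λ k → binom m k * f k)
    S₁ = sumTo m (λ k → binom m k * f (suc k))

  fromℕ-split : ∀ {k m} → k ℕ.≤ m → fromℕ m ≈ fromℕ k + fromℕ (m ℕ.∸ k)
  fromℕ-split {k} {m} k≤m = trans (reflexive (≡.cong fromℕ (≡.sym (ℕ.m+[n∸m]≡n k≤m))))
                                  (fromℕ-homo-+ k (m ℕ.∸ k))

  ⋆-congʳ : ∀ f {g h : Series} → (∀ k → g k ≈ h k) → ∀ m → (f ⋆ g) m ≈ (f ⋆ h) m
  ⋆-congʳ f g≈h m = sumTo-cong m (λ k → *-congˡ (*-congˡ (g≈h (m ℕ.∸ k))))

  ⋆-⊖-· : ∀ f g h a m → (f ⋆ (g ⊖ (a · h))) m ≈ (f ⋆ g) m - a * (f ⋆ h) m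
  ⋆-⊖-· f g h a m = begin
    (f ⋆ (g ⊖ (a · h))) m
      ≈⟨ sumTo-cong m (λ k → expand (binom m k) (f k) (g (m ℕ.∸ k)) (h (m ℕ.∸ k)) a) ⟩
    sumTo m (λ k → binom m k * (f k * g (m ℕ.∸ k)) - a * (binom m k * (f k * h (m ℕ.∸ k))))
      ≈⟨ sumTo-+ m _ _ ⟩
    (f ⋆ g) m + sumTo m (λ k → - (a * (binom m k * (f k * h (m ℕ.∸ k)))))
      ≈⟨ +-congˡ (trans (sumTo-neg m _) (-‿cong (sumTo-*ˡ m a _))) ⟩
    (f ⋆ g) m - a * (f ⋆ h) m ∎
    where
    expand : ∀ b x y z a → b * (x * (y - a * z)) ≈ b * (x * y) - a * (b * (x * z))
    expand = solve 5 (λ b x y z a →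
      b :* (x :* (y :- a :* z)) := b :* (x :* y) :- a :* (b :* (x :* z))) refl

  XD-diag : ∀ f k → XD f k ≈ fromℕ k * f k
  XD-diag f zero    = sym (zeroˡ _)
  XD-diag f (suc k) = refl

  -- XD multiplies the m-th coefficient by m = k + (m ∸ k).
  XD-⋆ : ∀ f g m → XD (f ⋆ g) m ≈ (XD f ⋆ g) m + (f ⋆ XD g) m
  XD-⋆ f g m = begin
    XD (f ⋆ g) m
      ≈⟨ XD-diag (f ⋆ g) m ⟩
    fromℕ m * (f ⋆ g) m
      ≈⟨ sumTo-*ˡ m (fromℕ m) _ ⟨
    sumTo m (λ k → fromℕ m * (binom m k * (f k * g (m ℕ.∸ k))))
      ≈⟨ sumTo-cong≤ m term ⟩
    sumTo m (λ k → binom m k * (XD f k * g (m ℕ.∸ k)) + binom m k * (f k * XD g (m ℕ.∸ k)))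
      ≈⟨ sumTo-+ m _ _ ⟩
    (XD f ⋆ g) m + (f ⋆ XD g) m ∎
    where
    leibniz : ∀ a b c x y → (a + b) * (c * (x * y)) ≈ c * ((a * x) * y) + c * (x * (b * y))
    leibniz = solve 5 (λ a b c x y →
      (a :+ b) :* (c :* (x :* y)) := c :* ((a :* x) :* y) :+ c :* (x :* (b :* y))) refl
    term : ∀ k → k ℕ.≤ m →
      fromℕ m * (binom m k * (f k * g (m ℕ.∸ k))) ≈
      binom m k * (XD f k * g (m ℕ.∸ k)) + binom m k * (f k * XD g (m ℕ.∸ k))
    term k k≤m = begin
      fromℕ m * (binom m k * (f k * g j))
        ≈⟨ *-congʳ (fromℕ-split k≤m) ⟩
      (fromℕ k + fromℕ j) * (binom m k * (f k * g j))
        ≈⟨ leibniz _ _ _ _ _ ⟩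
      binom m k * ((fromℕ k * f k) * g j) + binom m k * (f k * (fromℕ j * g j))
        ≈⟨ +-cong (*-congˡ (*-congʳ (XD-diag f k))) (*-congˡ (*-congˡ (XD-diag g j))) ⟨
      binom m k * (XD f k * g j) + binom m k * (f k * XD g j) ∎
      where
      j = m ℕ.∸ k

  X-⋆ : ∀ f g m → (X f ⋆ g) m ≈ X (f ⋆ g) m
  X-⋆ f g zero    = trans (*-congˡ (zeroˡ _)) (zeroʳ _)
  X-⋆ f g (suc m) = begin
    (X f ⋆ g) (suc m)
      ≈⟨ sumTo-suc m _ ⟩
    binom m 0 * (0# * g (suc m))
      + sumTo m (λ k → binom (suc m) (suc k) * ((fromℕ (suc k) * f k) * g (m ℕ.∸ k)))
      ≈⟨ +-cong (trans (*-congˡ (zeroˡ _)) (zeroʳ _)) (sumTo-cong m term) ⟩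
    0# + sumTo m (λ k → fromℕ (suc m) * (binom m k * (f k * g (m ℕ.∸ k))))
      ≈⟨ trans (+-identityˡ _) (sumTo-*ˡ m (fromℕ (suc m)) _) ⟩
    X (f ⋆ g) (suc m) ∎
    where
    regroup : ∀ b a x y → b * ((a * x) * y) ≈ (a * b) * (x * y)
    regroup = solve 4 (λ b a x y → b :* ((a :* x) :* y) := (a :* b) :* (x :* y)) refl
    term : ∀ k → binom (suc m) (suc k) * ((fromℕ (suc k) * f k) * g (m ℕ.∸ k)) ≈
                 fromℕ (suc m) * (binom m k * (f k * g (m ℕ.∸ k)))
    term k = trans (regroup _ _ _ _) (trans (*-congʳ (binom-absorb m k)) (*-assoc _ _ _))

  D-expNegS-⋆ : ∀ g m → (D expNegS ⋆ g) m ≈ - (expNegS ⋆ g) m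
  D-expNegS-⋆ g m = trans (sumTo-cong m (λ k → *-congˡ (sym (-‿distribˡ-* _ _))))
                          (trans (sumTo-cong m (λ k → sym (-‿distribʳ-* _ _))) (sumTo-neg m _))

  XD-expNegS-⋆ : ∀ g m → (XD expNegS ⋆ g) m ≈ - X (expNegS ⋆ g) m
  XD-expNegS-⋆ g zero    = trans (X-⋆ (D expNegS) g 0) (sym -0#≈0#)
  XD-expNegS-⋆ g (suc m) = trans (X-⋆ (D expNegS) g (suc m))
                                 (trans (*-congˡ (D-expNegS-⋆ g m)) (sym (-‿distribʳ-* _ _)))

  expNegS-⋆-XD : ∀ g m → (expNegS ⋆ XD g) m ≈ XD (expNegS ⋆ g) m + X (expNegS ⋆ g) m
  expNegS-⋆-XD g m = begin
    (expNegS ⋆ XD g) m                                            ≈⟨ cancel _ _ ⟩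
    (- X (expNegS ⋆ g) m + (expNegS ⋆ XD g) m) + X (expNegS ⋆ g) m
      ≈⟨ +-congʳ (trans (XD-⋆ expNegS g m) (+-congʳ (XD-expNegS-⋆ g m))) ⟨
    XD (expNegS ⋆ g) m + X (expNegS ⋆ g) m                        ∎
    where
    cancel : ∀ x y → y ≈ (- x + y) + x
    cancel = solve 2 (λ x y → y := (:- x :+ y) :+ x) refl

  expNegS-⋆-expS : ∀ m → (expNegS ⋆ expS) (suc m) ≈ 0#
  expNegS-⋆-expS m = trans (binomialSum-suc m (λ k → expNegS k * 1#))
                           (sumTo-zero m (λ k → trans (*-congˡ cancel) (zeroʳ _)))
    where
    cancel : ∀ {x} → x * 1# + - x * 1# ≈ 0#
    cancel = trans (sym (distribʳ _ _ _)) (trans (*-congʳ (-‿inverseʳ _)) (zeroˡ _))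

  X-cong : ∀ {g h : Series} → (∀ k → g k ≈ h k) → ∀ m → X g m ≈ X h m
  X-cong g≈h zero    = refl
  X-cong g≈h (suc m) = *-congˡ (g≈h m)

  XD-cong : ∀ {g h : Series} → (∀ k → g k ≈ h k) → ∀ m → XD g m ≈ XD h m
  XD-cong g≈h = X-cong (λ k → g≈h (suc k))

  -- conjXD a = e^{-x} ∘ (XD - a) ∘ e^{x}
  conjXD : Carrier → Series → Series
  conjXD a h = (XD h ⊕ X h) ⊖ (a · h)

  conjXD-cong : ∀ a {g h : Series} → (∀ k → g k ≈ h k) → ∀ m → conjXD a g m ≈ conjXD a h m
  conjXD-cong a g≈h m =
    +-cong (+-cong (XD-cong g≈h m) (X-cong g≈h m)) (-‿cong (*-congˡ (g≈h m)))

  expNegS-⋆-XD-shift : ∀ a g m → (expNegS ⋆ (XD g ⊖ (a · g))) m ≈ conjXD a (expNegS ⋆ g) m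
  expNegS-⋆-XD-shift a g m = trans (⋆-⊖-· expNegS (XD g) g a m) (+-congʳ (expNegS-⋆-XD g m))

module DegenerateStirling {c ℓ : Level} (R : CommutativeRing c ℓ) (lam : CommutativeRing.Carrier R)
  where
  open CommutativeRing R
  open Ops R
  open IntegerCoefficients R
  open ExponentialSeries R
  open RingProperties ring using (-0#≈0#)
  open import Relation.Binary.Reasoning.Setoid setoid

  fallingFactorial : Carrier → ℕ → Carrier
  fallingFactorial x zero    = 1#
  fallingFactorial x (suc n) = fallingFactorial x n * (x - fromℕ n * lam)

  fallingXD-diag : ∀ n f k → fallingXD lam n f k ≈ fallingFactorial (fromℕ k) n * f k
  fallingXD-diag zero    f k = sym (*-identityˡ _)
  fallingXD-diag (suc n) f k = begin
    fallingXD lam n (XD f ⊖ ((fromℕ n * lam) · f)) k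
      ≈⟨ fallingXD-diag n _ k ⟩
    fallingFactorial (fromℕ k) n * (XD f k - fromℕ n * lam * f k)
      ≈⟨ *-congˡ (+-congʳ (XD-diag f k)) ⟩
    fallingFactorial (fromℕ k) n * (fromℕ k * f k - fromℕ n * lam * f k)
      ≈⟨ factor _ _ _ _ ⟩
    fallingFactorial (fromℕ k) (suc n) * f k ∎
    where
    factor : ∀ p a b y → p * (a * y - b * y) ≈ p * (a - b) * y
    factor = solve 4 (λ p a b y → p :* (a :* y :- b :* y) := p :* (a :- b) :* y) refl

  fallingXD-suc : ∀ n f k →
    fallingXD lam (suc n) f k ≈ (XD (fallingXD lam n f) ⊖ ((fromℕ n * lam) · fallingXD lam n f)) k
  fallingXD-suc n f k = begin
    fallingXD lam (suc n) f k                       ≈⟨ fallingXD-diag (suc n) f k ⟩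
    p * (fromℕ k - nλ) * f k                         ≈⟨ distribute _ _ _ _ ⟩
    fromℕ k * (p * f k) - nλ * (p * f k)             ≈⟨ +-cong (*-congˡ g≈) (-‿cong (*-congˡ g≈)) ⟨
    fromℕ k * g k - nλ * g k                         ≈⟨ +-congʳ (XD-diag g k) ⟨
    (XD g ⊖ (nλ · g)) k                              ∎
    where
    p = fallingFactorial (fromℕ k) n
    nλ = fromℕ n * lam
    g = fallingXD lam n f
    g≈ : g k ≈ p * f k
    g≈ = fallingXD-diag n f k
    distribute : ∀ p a b y → p * (a - b) * y ≈ a * (p * y) - b * (p * y)
    distribute = solve 4 (λ p a b y → p :* (a :- b) :* y := a :* (p :* y) :- b :* (p :* y)) refl

  stirling2-vanish : ∀ {n k} → n ℕ.< k → stirling2 lam n k ≈ 0#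
  stirling2-vanish {zero}  {suc k} _           = refl
  stirling2-vanish {suc n} {suc k} (s≤s n<k) =
    trans (+-cong (stirling2-vanish n<k)
                  (trans (*-congˡ (stirling2-vanish (ℕ.m<n⇒m<1+n n<k))) (zeroʳ _)))
          (+-identityˡ 0#)

  bellφ-coeff : ∀ n k → bellφ lam n k ≈ fromℕ (k !) * stirling2 lam n k
  bellφ-coeff n k with k ℕ.≤ᵇ n in k≤ᵇn
  ... | true  = refl
  ... | false = sym (trans (*-congˡ (stirling2-vanish n<k)) (zeroʳ _))
    where
    n<k : n ℕ.< k
    n<k = ℕ.≰⇒> (λ k≤n → ≡.subst T k≤ᵇn (ℕ.≤⇒≤ᵇ k≤n))

  nλ*bellφ-0≈0 : ∀ n → fromℕ n * lam * bellφ lam n 0 ≈ 0#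
  nλ*bellφ-0≈0 zero    = trans (*-congʳ (zeroˡ lam)) (zeroˡ _)
  nλ*bellφ-0≈0 (suc n) = trans (*-congˡ (zeroʳ _)) (zeroʳ _)

  bellφ-suc : ∀ n m → bellφ lam (suc n) m ≈ conjXD (fromℕ n * lam) (bellφ lam n) m
  bellφ-suc n zero = begin
    bellφ lam (suc n) 0                           ≈⟨ zeroʳ _ ⟩
    0#                                            ≈⟨ -0#≈0# ⟨
    - 0#                                          ≈⟨ -‿cong (nλ*bellφ-0≈0 n) ⟨
    - (fromℕ n * lam * bellφ lam n 0)             ≈⟨ +-identityˡ _ ⟨
    0# - fromℕ n * lam * bellφ lam n 0            ≈⟨ +-congʳ (+-identityʳ 0#) ⟨
    conjXD (fromℕ n * lam) (bellφ lam n) 0        ∎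
  bellφ-suc n (suc m) = begin
    bellφ lam (suc n) (suc m)
      ≈⟨ bellφ-coeff (suc n) (suc m) ⟩
    fromℕ (suc m !) * (s₀ + (a - nλ) * s₁)
      ≈⟨ *-congʳ (fromℕ-homo-* (suc m) (m !)) ⟩
    a * b * (s₀ + (a - nλ) * s₁)
      ≈⟨ recurrence a b nλ s₀ s₁ ⟩
    (a * (a * b * s₁) + a * (b * s₀)) - nλ * (a * b * s₁)
      ≈⟨ +-cong (+-cong (*-congˡ φ₁) (*-congˡ φ₀)) (-‿cong (*-congˡ φ₁)) ⟨
    (a * bellφ lam n (suc m) + a * bellφ lam n m) - nλ * bellφ lam n (suc m) ∎
    where
    a = fromℕ (suc m)
    b = fromℕ (m !)
    nλ = fromℕ n * lam
    s₀ = stirling2 lam n m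
    s₁ = stirling2 lam n (suc m)
    φ₀ : bellφ lam n m ≈ b * s₀
    φ₀ = bellφ-coeff n m
    φ₁ : bellφ lam n (suc m) ≈ a * b * s₁
    φ₁ = trans (bellφ-coeff n (suc m)) (*-congʳ (fromℕ-homo-* (suc m) (m !)))
    recurrence : ∀ a b t s₀ s₁ →
      a * b * (s₀ + (a - t) * s₁) ≈ (a * (a * b * s₁) + a * (b * s₀)) - t * (a * b * s₁)
    recurrence = solve 5 (λ a b t s₀ s₁ →
      a :* b :* (s₀ :+ (a :- t) :* s₁) :=
      (a :* (a :* b :* s₁) :+ a :* (b :* s₀)) :- t :* (a :* b :* s₁)) refl

theorem2p1 : ∀ {c ℓ : Level} (R : CommutativeRing c ℓ) →
    let open CommutativeRing R in
    let open Ops R in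
    (lam : Carrier) → ¬ (lam ≈ 0#) → (n : ℕ) →
    ∀ (k : ℕ) → (expNegS ⋆ fallingXD lam n expS) k ≈ bellφ lam n k
theorem2p1 R lam _ = conv≈bellφ
  where
  open CommutativeRing R
  open Ops R
  open ExponentialSeries R
  open DegenerateStirling R lam
  open import Relation.Binary.Reasoning.Setoid setoid

  conv≈bellφ : ∀ n k → (expNegS ⋆ fallingXD lam n expS) k ≈ bellφ lam n k
  conv≈bellφ zero    zero    = *-congˡ (*-identityʳ 1#)
  conv≈bellφ zero    (suc k) = expNegS-⋆-expS k
  conv≈bellφ (suc n) k       = begin
    (expNegS ⋆ fallingXD lam (suc n) expS) k  ≈⟨ ⋆-congʳ expNegS (fallingXD-suc n expS) k ⟩
    (expNegS ⋆ (XD g ⊖ (nλ · g))) k           ≈⟨ expNegS-⋆-XD-shift nλ g k ⟩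
    conjXD nλ (expNegS ⋆ g) k                 ≈⟨ conjXD-cong nλ (conv≈bellφ n) k ⟩
    conjXD nλ (bellφ lam n) k                 ≈⟨ bellφ-suc n k ⟨
    bellφ lam (suc n) k                       ∎
    where
    nλ = fromℕ n * lam
    g = fallingXD lam n expS
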